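{- Let $X\subseteq\vartheta(\varepsilon_{\Omega+1})$. (a) If $\alpha\prec\beta$, then $\mathcal H_\alpha(X)\subseteq\mathcal H_\beta(X)$. (b) If $\alpha\in\mathcal H_\beta(X)$ and $\alpha\preceq\beta$, then $\vartheta\alpha\in\mathcal H_\beta(X)$. (c) If $X\subseteq\bigcap\{C_\gamma(\vartheta\gamma)\mid\alpha\prec\gamma\}$, then for all $\beta,\gamma$: if $\alpha\preceq\beta\prec\gamma$ and $\beta\in\mathcal H_\alpha(X)$, then $\vartheta\beta\prec\vartheta\gamma$.
   Context: Terms $\vartheta(\varepsilon_{\Omega+1})$, relation $\prec$ and finite sets $E(\alpha)$ are defined by simultaneous recursion on term length: Terms: $\Omega$; $\vartheta\alpha$ for every term $\alpha$; $\langle\alpha_0,\dots,\alpha_{n-1}\rangle$ ($n\ge0$) for terms $\alpha_i$, provided that if $n>1$ then $\alpha_{n-1}\preceq\dots\preceq\alpha_0$ ($\preceq$ meaning $\prec$ or syntactic equality), and if $n=1$ then $\alpha_0$ is not of the form $\Omega$ or $\vartheta\beta$. $E(\Omega)=\emptyset$, $E(\vartheta\alpha)=\{\vartheta\alpha\}$, $E(\langle\alpha_0,\dots,\alpha_{n-1}\rangle)=\bigcup_{i<n}E(\alpha_i)$. $\alpha\prec\beta$ holds iff: (1) $\alpha=\Omega$ and $\beta=\langle\beta_0,\dots,\beta_{n-1}\rangle$ with $n>0$, $\Omega\preceq\beta_0$; or (2) $\alpha=\vartheta\alpha'$ and one of: $\beta=\Omega$; $\beta=\langle\beta_0,\dots,\beta_{n-1}\rangle$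 with $n>0$, $\alpha\preceq\beta_0$; $\beta=\vartheta\beta'$ with $\alpha'\prec\beta'$ and $\gamma\prec\beta$ for all $\gamma\in E(\alpha')$; $\beta=\vartheta\beta'$ with $\alpha\preceq\gamma$ for some $\gamma\in E(\beta')$; or (3) $\alpha=\langle\alpha_0,\dots,\alpha_{m-1}\rangle$ and one of: $\beta$ is $\Omega$ or some $\vartheta\beta'$, and $m=0$ or $\alpha_0\prec\beta$; $\beta=\langle\beta_0,\dots,\beta_{n-1}\rangle$ and for some $j\le\min(m,n)$, $\alpha_i=\beta_i$ for all $i<j$ and either $j=m<n$ or ($j<\min(m,n)$ and $\alpha_j\prec\beta_j$). $C_\alpha(\beta)$ is the least set containing $\Omega$ and all $\gamma\prec\beta$, containing $\vartheta\gamma$ whenever it contains $\gamma$ with $\gamma\prec\alpha$, and containing every term $\langle\gamma_0,\dots,\gamma_{n-1}\rangle$ whose entries it contains. For a term $\alpha$ and $X\subseteq\vartheta(\varepsilon_{\Omega+1})$, $\mathcal H_\alpha(X)=\bigcap\{C_\gamma(\delta)\mid\gamma,\delta\in\vartheta(\varepsilon_{\Omega+1}),\ \alpha\prec\gamma,\ X\subseteq C_\gamma(\delta)\}$, with $\mathcal H_\alpha(X)=\vartheta(\varepsilon_{\Omega+1})$ if no such $\gamma,\delta$ exist. -}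

module Defs where

open import Data.List using (List; []; _∷_; concatMap; [_])
open import Data.List.Relation.Unary.All using (All)
open import Data.List.Relation.Unary.Any using (Any)
open import Data.Sum using (_⊎_)
open import Data.Product using (_×_)
open import Relation.Binary.PropositionalEquality using (_≡_)
open import Relation.Unary using (Pred; _⊆_; _∈_)
open import Level using (0ℓ)

-- Raw terms (well-formedness is imposed separately by WF below).
data Tm : Set where
  Ω   : Tm
  ϑ   : Tm → Tm
  ⟨_⟩ : List Tm → Tm

mutual
  E : Tm → List Tm
  E Ω         = []
  E (ϑ a)     = [ ϑ a ]
  E ⟨ as ⟩    = Es as

  Es : List Tm → List Tm
  Es []       = []
  Es (a ∷ as) = Data.List._++_ (E a) (Es as)

-- The relation ≺ (least relation closed under the clauses; this coincides
-- with the definition by recursion on term length), its reflexive closure ⪯,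
-- and the lexicographic comparison of sequences.
mutual
  data _≺_ : Tm → Tm → Set where
    Ω≺⟨⟩   : ∀ {b bs} → Ω ⪯ b → Ω ≺ ⟨ b ∷ bs ⟩
    ϑ≺Ω    : ∀ {a} → ϑ a ≺ Ω
    ϑ≺⟨⟩   : ∀ {a b bs} → ϑ a ⪯ b → ϑ a ≺ ⟨ b ∷ bs ⟩
    ϑ≺ϑ₁   : ∀ {a b} → a ≺ b → All (λ g → g ≺ ϑ b) (E a) → ϑ a ≺ ϑ b
    ϑ≺ϑ₂   : ∀ {a b} → Any (λ g → ϑ a ⪯ g) (E b) → ϑ a ≺ ϑ b
    ⟨⟩≺Ω₀  : ⟨ [] ⟩ ≺ Ω
    ⟨⟩≺Ω   : ∀ {a as} → a ≺ Ω → ⟨ a ∷ as ⟩ ≺ Ω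
    ⟨⟩≺ϑ₀  : ∀ {b} → ⟨ [] ⟩ ≺ ϑ b
    ⟨⟩≺ϑ   : ∀ {a as b} → a ≺ ϑ b → ⟨ a ∷ as ⟩ ≺ ϑ b
    ⟨⟩≺⟨⟩  : ∀ {as bs} → Lex as bs → ⟨ as ⟩ ≺ ⟨ bs ⟩

  data _⪯_ : Tm → Tm → Set where
    lt : ∀ {a b} → a ≺ b → a ⪯ b
    eq : ∀ {a} → a ⪯ a

  data Lex : List Tm → List Tm → Set where
    []<∷  : ∀ {b bs} → Lex [] (b ∷ bs)
    head< : ∀ {a as b bs} → a ≺ b → Lex (a ∷ as) (b ∷ bs)
    tail< : ∀ {a as bs} → Lex as bs → Lex (a ∷ as) (a ∷ bs)

-- Terms with a single entry must not be Ω or of the form ϑβ.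
data NotPrincipal : Tm → Set where
  np : ∀ as → NotPrincipal ⟨ as ⟩

data Desc : List Tm → Set where
  d[]  : Desc []
  d[_] : ∀ a → Desc (a ∷ [])
  d∷   : ∀ {a b as} → b ⪯ a → Desc (b ∷ as) → Desc (a ∷ b ∷ as)

-- Well-formedness: the raw term is an element of ϑ(ε_{Ω+1}).
data WF : Tm → Set where
  wfΩ  : WF Ω
  wfϑ  : ∀ {a} → WF a → WF (ϑ a)
  wf0  : WF ⟨ [] ⟩
  wf1  : ∀ {a} → WF a → NotPrincipal a → WF ⟨ a ∷ [] ⟩
  wfn  : ∀ {a b as} → All WF (a ∷ b ∷ as) → Desc (a ∷ b ∷ as) → WF ⟨ a ∷ b ∷ as ⟩

Term : Pred Tm 0ℓ
Term = WF

data C (α β : Tm) : Tm → Set where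
  cΩ   : C α β Ω
  c≺   : ∀ {g} → WF g → g ≺ β → C α β g
  cϑ   : ∀ {g} → C α β g → g ≺ α → C α β (ϑ g)
  c⟨⟩  : ∀ {gs} → WF ⟨ gs ⟩ → All (C α β) gs → C α β ⟨ gs ⟩

-- H_α(X): intersection of all C_γ(δ) (γ, δ terms, α ≺ γ, X ⊆ C_γ(δ)),
-- taken inside ϑ(ε_{Ω+1}) (so it is the whole set of terms if the family is empty).
H : Tm → Pred Tm 0ℓ → Pred Tm 0ℓ
H α X ξ = WF ξ × (∀ γ δ → WF γ → WF δ → α ≺ γ → X ⊆ C γ δ → ξ ∈ C γ δ)

{-# OPTIONS --safe #-}
module Submission where

open import Defs
open import Data.Product using (_×_; _,_)
open import Relation.Unary using (Pred; _⊆_; _∈_)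
open import Level using (0ℓ)
open import Data.List using (List; []; _∷_)
open import Data.List.Relation.Unary.All using (All; []; _∷_)
open import Data.List.Relation.Unary.Any using (Any; here; there)
open import Data.List.Relation.Unary.All.Properties using (++⁺)

-- Parts (a) and (b) only use that H_α(X) is an intersection over a family that
-- shrinks as α grows and whose members C_γ(δ) are closed under ϑ below γ.
-- For (c), taking γ ≻ α and δ = ϑγ puts β into C_γ(ϑγ); every element of E(β)
-- is then ≺ ϑγ, which together with β ≺ γ is the first ϑ-clause of ϑβ ≺ ϑγ.

mutual
  ≺-trans : ∀ {a b c} → a ≺ b → b ≺ c → a ≺ c
  ≺-trans (Ω≺⟨⟩ e) (⟨⟩≺Ω r) with () ← ⪯-≺-trans e r
  ≺-trans (Ω≺⟨⟩ e) (⟨⟩≺ϑ r) with () ← ⪯-≺-trans e r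
  ≺-trans (Ω≺⟨⟩ e) (⟨⟩≺⟨⟩ (head< r)) = Ω≺⟨⟩ (lt (⪯-≺-trans e r))
  ≺-trans (Ω≺⟨⟩ e) (⟨⟩≺⟨⟩ (tail< _)) = Ω≺⟨⟩ e
  ≺-trans ϑ≺Ω (Ω≺⟨⟩ e) = ϑ≺⟨⟩ (lt (≺-⪯-trans ϑ≺Ω e))
  ≺-trans (ϑ≺⟨⟩ e) (⟨⟩≺Ω _) = ϑ≺Ω
  ≺-trans (ϑ≺⟨⟩ e) (⟨⟩≺ϑ r) = ⪯-≺-trans e r
  ≺-trans (ϑ≺⟨⟩ e) (⟨⟩≺⟨⟩ (head< r)) = ϑ≺⟨⟩ (lt (⪯-≺-trans e r))
  ≺-trans (ϑ≺⟨⟩ e) (⟨⟩≺⟨⟩ (tail< _)) = ϑ≺⟨⟩ e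
  ≺-trans (ϑ≺ϑ₁ _ _) ϑ≺Ω = ϑ≺Ω
  ≺-trans (ϑ≺ϑ₂ _) ϑ≺Ω = ϑ≺Ω
  ≺-trans p@(ϑ≺ϑ₁ _ _) (ϑ≺⟨⟩ e) = ϑ≺⟨⟩ (lt (≺-⪯-trans p e))
  ≺-trans p@(ϑ≺ϑ₂ _) (ϑ≺⟨⟩ e) = ϑ≺⟨⟩ (lt (≺-⪯-trans p e))
  ≺-trans p@(ϑ≺ϑ₁ _ _) (ϑ≺ϑ₂ y) = ϑ≺ϑ₂ (≺-Any-⪯ p y)
  ≺-trans p@(ϑ≺ϑ₂ _) (ϑ≺ϑ₂ y) = ϑ≺ϑ₂ (≺-Any-⪯ p y)
  ≺-trans (ϑ≺ϑ₁ x xs) q@(ϑ≺ϑ₁ y _) = ϑ≺ϑ₁ (≺-trans x y) (All-≺-trans xs q)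
  ≺-trans (ϑ≺ϑ₂ x) (ϑ≺ϑ₁ _ ys) = Any-⪯-All-≺-trans x ys
  ≺-trans ⟨⟩≺Ω₀ (Ω≺⟨⟩ _) = ⟨⟩≺⟨⟩ []<∷
  ≺-trans (⟨⟩≺Ω r) (Ω≺⟨⟩ e) = ⟨⟩≺⟨⟩ (head< (≺-⪯-trans r e))
  ≺-trans ⟨⟩≺ϑ₀ ϑ≺Ω = ⟨⟩≺Ω₀
  ≺-trans ⟨⟩≺ϑ₀ (ϑ≺⟨⟩ _) = ⟨⟩≺⟨⟩ []<∷
  ≺-trans ⟨⟩≺ϑ₀ (ϑ≺ϑ₁ _ _) = ⟨⟩≺ϑ₀
  ≺-trans ⟨⟩≺ϑ₀ (ϑ≺ϑ₂ _) = ⟨⟩≺ϑ₀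
  ≺-trans (⟨⟩≺ϑ r) q@ϑ≺Ω = ⟨⟩≺Ω (≺-trans r q)
  ≺-trans (⟨⟩≺ϑ r) (ϑ≺⟨⟩ e) = ⟨⟩≺⟨⟩ (head< (≺-⪯-trans r e))
  ≺-trans (⟨⟩≺ϑ r) q@(ϑ≺ϑ₁ _ _) = ⟨⟩≺ϑ (≺-trans r q)
  ≺-trans (⟨⟩≺ϑ r) q@(ϑ≺ϑ₂ _) = ⟨⟩≺ϑ (≺-trans r q)
  ≺-trans (⟨⟩≺⟨⟩ []<∷) (⟨⟩≺Ω _) = ⟨⟩≺Ω₀
  ≺-trans (⟨⟩≺⟨⟩ (head< x)) (⟨⟩≺Ω r) = ⟨⟩≺Ω (≺-trans x r)
  ≺-trans (⟨⟩≺⟨⟩ (tail< _)) (⟨⟩≺Ω r) = ⟨⟩≺Ω r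
  ≺-trans (⟨⟩≺⟨⟩ []<∷) (⟨⟩≺ϑ _) = ⟨⟩≺ϑ₀
  ≺-trans (⟨⟩≺⟨⟩ (head< x)) (⟨⟩≺ϑ r) = ⟨⟩≺ϑ (≺-trans x r)
  ≺-trans (⟨⟩≺⟨⟩ (tail< _)) (⟨⟩≺ϑ r) = ⟨⟩≺ϑ r
  ≺-trans (⟨⟩≺⟨⟩ l) (⟨⟩≺⟨⟩ l′) = ⟨⟩≺⟨⟩ (Lex-trans l l′)

  ⪯-≺-trans : ∀ {a b c} → a ⪯ b → b ≺ c → a ≺ c
  ⪯-≺-trans (lt p) q = ≺-trans p q
  ⪯-≺-trans eq q = q

  ≺-⪯-trans : ∀ {a b c} → a ≺ b → b ⪯ c → a ≺ c
  ≺-⪯-trans p (lt q) = ≺-trans p q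
  ≺-⪯-trans p eq = p

  Lex-trans : ∀ {as bs cs} → Lex as bs → Lex bs cs → Lex as cs
  Lex-trans []<∷ (head< _) = []<∷
  Lex-trans []<∷ (tail< _) = []<∷
  Lex-trans (head< x) (head< y) = head< (≺-trans x y)
  Lex-trans (head< x) (tail< _) = head< x
  Lex-trans (tail< _) (head< y) = head< y
  Lex-trans (tail< l) (tail< l′) = tail< (Lex-trans l l′)

  ≺-Any-⪯ : ∀ {a b l} → a ≺ b → Any (b ⪯_) l → Any (a ⪯_) l
  ≺-Any-⪯ p (here e) = here (lt (≺-⪯-trans p e))
  ≺-Any-⪯ p (there y) = there (≺-Any-⪯ p y)

  All-≺-trans : ∀ {b c l} → All (_≺ b) l → b ≺ c → All (_≺ c) l
  All-≺-trans [] q = []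
  All-≺-trans (x ∷ xs) q = ≺-trans x q ∷ All-≺-trans xs q

  Any-⪯-All-≺-trans : ∀ {a c l} → Any (a ⪯_) l → All (_≺ c) l → a ≺ c
  Any-⪯-All-≺-trans (here e) (y ∷ _) = ⪯-≺-trans e y
  Any-⪯-All-≺-trans (there x) (_ ∷ ys) = Any-⪯-All-≺-trans x ys

Desc-All-≺ : ∀ {a l t} → Desc (a ∷ l) → a ≺ t → All (_≺ t) (a ∷ l)
Desc-All-≺ d[ _ ] r = r ∷ []
Desc-All-≺ (d∷ e d) r = r ∷ Desc-All-≺ d (⪯-≺-trans e r)

mutual
  E-≺ϑ : ∀ {g t} → WF g → g ≺ ϑ t → All (_≺ ϑ t) (E g)
  E-≺ϑ wfΩ _ = []
  E-≺ϑ (wfϑ _) r = r ∷ []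
  E-≺ϑ wf0 _ = []
  E-≺ϑ (wf1 w _) (⟨⟩≺ϑ r) = ++⁺ (E-≺ϑ w r) []
  E-≺ϑ (wfn ws d) (⟨⟩≺ϑ r) = Es-≺ϑ ws (Desc-All-≺ d r)

  Es-≺ϑ : ∀ {l t} → All WF l → All (_≺ ϑ t) l → All (_≺ ϑ t) (Es l)
  Es-≺ϑ [] [] = []
  Es-≺ϑ (w ∷ ws) (r ∷ rs) = ++⁺ (E-≺ϑ w r) (Es-≺ϑ ws rs)

mutual
  C-ϑ-E-≺ϑ : ∀ {γ β} → C γ (ϑ γ) β → All (_≺ ϑ γ) (E β)
  C-ϑ-E-≺ϑ cΩ = []
  C-ϑ-E-≺ϑ (c≺ w r) = E-≺ϑ w r
  C-ϑ-E-≺ϑ (cϑ c r) = ϑ≺ϑ₁ r (C-ϑ-E-≺ϑ c) ∷ []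
  C-ϑ-E-≺ϑ (c⟨⟩ _ cs) = C-ϑ-Es-≺ϑ cs

  C-ϑ-Es-≺ϑ : ∀ {γ l} → All (C γ (ϑ γ)) l → All (_≺ ϑ γ) (Es l)
  C-ϑ-Es-≺ϑ [] = []
  C-ϑ-Es-≺ϑ (c ∷ cs) = ++⁺ (C-ϑ-E-≺ϑ c) (C-ϑ-Es-≺ϑ cs)

H-mono : ∀ {α β} (X : Pred Tm 0ℓ) → α ≺ β → H α X ⊆ H β X
H-mono X α≺β (w , h) = w , λ γ δ wγ wδ β≺γ X⊆C → h γ δ wγ wδ (≺-trans α≺β β≺γ) X⊆C

H-ϑ-closed : ∀ {α β} (X : Pred Tm 0ℓ) → α ∈ H β X → α ⪯ β → ϑ α ∈ H β X
H-ϑ-closed X (w , h) α⪯β =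
  wfϑ w , λ γ δ wγ wδ β≺γ X⊆C → cϑ (h γ δ wγ wδ β≺γ X⊆C) (⪯-≺-trans α⪯β β≺γ)

H-ϑ-mono : ∀ {α} (X : Pred Tm 0ℓ) →
  (∀ {ξ} → ξ ∈ X → (γ : Tm) → WF γ → α ≺ γ → ξ ∈ C γ (ϑ γ)) →
  ∀ {β γ} → WF γ → α ⪯ β → β ≺ γ → β ∈ H α X → ϑ β ≺ ϑ γ
H-ϑ-mono X X⊆C wγ α⪯β β≺γ (_ , h) =
  ϑ≺ϑ₁ β≺γ (C-ϑ-E-≺ϑ (h _ _ wγ (wfϑ wγ) α≺γ (λ ξ∈X → X⊆C ξ∈X _ wγ α≺γ)))
  where α≺γ = ⪯-≺-trans α⪯β β≺γ

proposition3p11 : (X : Pred Tm 0ℓ) → X ⊆ WF →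
    ((α β : Tm) → WF α → WF β → α ≺ β → H α X ⊆ H β X)
    × ((α β : Tm) → WF α → WF β → α ∈ H β X → α ⪯ β → ϑ α ∈ H β X)
    × ((α : Tm) → WF α → (∀ {ξ} → ξ ∈ X → (γ : Tm) → WF γ → α ≺ γ → ξ ∈ C γ (ϑ γ))
       → (β γ : Tm) → WF β → WF γ → α ⪯ β → β ≺ γ → β ∈ H α X → ϑ β ≺ ϑ γ)
proposition3p11 X _ =
    (λ _ _ _ _ → H-mono X)
  , (λ _ _ _ _ → H-ϑ-closed X)
  , (λ _ _ X⊆C _ _ _ wγ → H-ϑ-mono X X⊆C wγ)
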